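{- Let $G=(V,E)$ be a directed graph with $n$ vertices and let $C_1,\ldots,C_t$ be the $2$-vertex-connected components of $G$. Then $\sum_{i=1}^{t}|C_i|<3n$.
   Context: For $U\subseteq V$, $G[U]$ is the induced subgraph. $G$ is $2$-vertex-connected if it has at least $3$ vertices and $G[V\setminus X]$ is strongly connected for every $X\subset V$ with $|X|<2$. The $2$-vertex-connected components of $G$ are its maximal $2$-vertex-connected subgraphs, identified with their vertex sets $C_i$. -}

module Defs where

open import Data.Nat using (ℕ; _<_; _≤_)
open import Data.Fin using (Fin)
open import Data.Fin.Subset using (Subset; _∈_; _⊆_; _⊂_; _∩_; ∁; ∣_∣)
open import Data.Bool using (Bool; true)
open import Data.Product using (_×_)
open import Relation.Binary.PropositionalEquality using (_≡_)
open import Relation.Nullary using (¬_)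

Digraph : ℕ → Set
Digraph n = Fin n → Fin n → Bool

-- Path U u v : a directed path from u to v in G, all of whose vertices
-- after u lie in U (u itself is required to be in U by the users below).
data Path {n : ℕ} (E : Digraph n) (U : Subset n) : Fin n → Fin n → Set where
  here : ∀ {u} → Path E U u u
  step : ∀ {u w v} → E u w ≡ true → w ∈ U → Path E U w v → Path E U u v

StronglyConnected : ∀ {n} → Digraph n → Subset n → Set
StronglyConnected E U = ∀ u v → u ∈ U → v ∈ U → Path E U u v

TwoVertexConnected : ∀ {n} → Digraph n → Subset n → Set
TwoVertexConnected E U =
  (3 ≤ ∣ U ∣) × (∀ X → X ⊆ U → ∣ X ∣ < 2 → StronglyConnected E (U ∩ ∁ X))

IsTwoVCC : ∀ {n} → Digraph n → Subset n → Set
IsTwoVCC E C = TwoVertexConnected E C × (∀ D → C ⊂ D → ¬ TwoVertexConnected E D)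

module Submission where

-- Let C₁, …, C_t be the distinct 2-vertex-connected components of a digraph
-- on n > 0 vertices and S = Σ |Cᵢ|.  Each |Cᵢ| ≥ 3 gives 3t ≤ S; we show
-- S ≤ t + n, which yields 2S ≤ 3n and hence S < 3n.
--
-- S ≤ t + n says that the vertex/component incidence structure is a forest.
-- We process the components one by one, maintaining a family of disjoint
-- "blobs" covering all vertices (initially the singletons) such that any two
-- vertices of a blob are joined inside it by a "link" containing a processed
-- component (links are chains of blocks glued at cut vertices), and
-- S_L + #blobs ≤ |L| + n, where S_L is the size sum over processed L.  The key
-- lemma: a new component C meets each blob in at most one vertex, since
-- otherwise attaching the link to C would give a larger 2-vertex-connected
-- set.  So the blobs meeting C number at least |C|, and merging them with C
-- lowers #blobs by at least |C| - 1, which preserves the inequality.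

open import Data.Nat using (ℕ)
open import Defs

module SubsetFacts where

  open import Data.Nat using (_<_; _≤_; _+_; z≤n; s≤s)
  open import Data.Nat.Properties using (≤-trans; ≤-reflexive; ≤-<-trans; <⇒≱; +-suc; +-monoʳ-≤; n≤1+n)
  open import Data.Fin using (Fin; _≟_)
  open import Data.Fin.Properties using (any?)
  open import Data.Fin.Subset
  open import Data.Fin.Subset.Properties
  open import Data.Vec.Base using ([]; _∷_)
  open import Data.Product using (∃; _×_; _,_)
  open import Data.Sum using (inj₁; inj₂)
  open import Data.Empty using (⊥-elim)
  open import Relation.Nullary using (yes; no; ¬_)
  open import Relation.Nullary.Decidable using (_×-dec_; ¬?)
  open import Relation.Binary.PropositionalEquality using (_≡_; sym; subst)

  private
    variable
      n : ℕ
      x y : Fin n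
      p q : Subset n

  infixl 5 _∖_
  _∖_ : Subset n → Subset n → Subset n
  p ∖ q = p ∩ ∁ q

  x∈p∖q⁺ : x ∈ p → x ∉ q → x ∈ p ∖ q
  x∈p∖q⁺ x∈p x∉q = x∈p∩q⁺ (x∈p , x∉p⇒x∈∁p x∉q)

  x∈p∖q⁻ : ∀ (p q : Subset n) → x ∈ p ∖ q → x ∈ p × x ∉ q
  x∈p∖q⁻ p q x∈p∖q with x∈p∩q⁻ p (∁ q) x∈p∖q
  ... | x∈p , x∈∁q = x∈p , x∈∁p⇒x∉p x∈∁q

  ∖-monoˡ : ∀ {p q} (r : Subset n) → p ⊆ q → p ∖ r ⊆ q ∖ r
  ∖-monoˡ {p = p} r p⊆q x∈p∖r with x∈p∖q⁻ p r x∈p∖r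
  ... | x∈p , x∉r = x∈p∖q⁺ (p⊆q x∈p) x∉r

  ∩-monoʳ : ∀ {q r} (p : Subset n) → q ⊆ r → p ∩ q ⊆ p ∩ r
  ∩-monoʳ {q = q} p q⊆r x∈p∩q with x∈p∩q⁻ p q x∈p∩q
  ... | x∈p , x∈q = x∈p∩q⁺ (x∈p , q⊆r x∈q)

  ∪-least : ∀ {p q r : Subset n} → p ⊆ r → q ⊆ r → p ∪ q ⊆ r
  ∪-least {p = p} {q} p⊆r q⊆r x∈p∪q with x∈p∪q⁻ p q x∈p∪q
  ... | inj₁ x∈p = p⊆r x∈p
  ... | inj₂ x∈q = q⊆r x∈q

  ∪-swap : ∀ (p q : Subset n) → p ∪ q ⊆ q ∪ p
  ∪-swap p q x∈p∪q with x∈p∪q⁻ p q x∈p∪q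
  ... | inj₁ x∈p = q⊆p∪q q p x∈p
  ... | inj₂ x∈q = p⊆p∪q p x∈q

  AtMostOne : Subset n → Set
  AtMostOne X = ∀ {x y} → x ∈ X → y ∈ X → x ≡ y

  ∈⇒∣p∣>0 : x ∈ p → 0 < ∣ p ∣
  ∈⇒∣p∣>0 x∈p = ≤-<-trans z≤n (x∈p⇒∣p-x∣<∣p∣ x∈p)

  -- A set of fewer than two vertices has at most one element: if x ≢ y
  -- both lie in X, then X - x is nonempty and strictly smaller than X.
  ∣X∣<2⇒AtMostOne : ∀ {X : Subset n} → ∣ X ∣ < 2 → AtMostOne X
  ∣X∣<2⇒AtMostOne ∣X∣<2 {x} {y} x∈X y∈X with y ≟ x
  ... | yes y≡x = sym y≡x
  ... | no y≢x = ⊥-elim (<⇒≱ ∣X∣<2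
    (≤-trans (s≤s (∈⇒∣p∣>0 (x∈p∧x≢y⇒x∈p-y y∈X y≢x))) (x∈p⇒∣p-x∣<∣p∣ x∈X)))

  AtMostOne⇒∣X∣≤1 : ∀ (X : Subset n) → AtMostOne X → ∣ X ∣ ≤ 1
  AtMostOne⇒∣X∣≤1 {n} X amo with nonempty? X
  ... | yes (x , x∈X) = ≤-trans (p⊆q⇒∣p∣≤∣q∣ X⊆⁅x⁆) (≤-reflexive (∣⁅x⁆∣≡1 x))
    where
    X⊆⁅x⁆ : X ⊆ ⁅ x ⁆
    X⊆⁅x⁆ y∈X = subst (_∈ ⁅ x ⁆) (amo x∈X y∈X) (x∈⁅x⁆ x)
  ... | no X-empty = ≤-trans (p⊆q⇒∣p∣≤∣q∣ X⊆⊥) (≤-trans (≤-reflexive (∣⊥∣≡0 n)) z≤n)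
    where
    X⊆⊥ : X ⊆ ⊥
    X⊆⊥ x∈X = ⊥-elim (X-empty (_ , x∈X))

  ∣p∪q∣≤∣p∣+∣q∣ : ∀ (p q : Subset n) → ∣ p ∪ q ∣ ≤ ∣ p ∣ + ∣ q ∣
  ∣p∪q∣≤∣p∣+∣q∣ []            []            = z≤n
  ∣p∪q∣≤∣p∣+∣q∣ (inside ∷ p)  (inside ∷ q)  =
    s≤s (≤-trans (∣p∪q∣≤∣p∣+∣q∣ p q) (+-monoʳ-≤ ∣ p ∣ (n≤1+n ∣ q ∣)))
  ∣p∪q∣≤∣p∣+∣q∣ (inside ∷ p)  (outside ∷ q) = s≤s (∣p∪q∣≤∣p∣+∣q∣ p q)
  ∣p∪q∣≤∣p∣+∣q∣ (outside ∷ p) (inside ∷ q)  =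
    ≤-trans (s≤s (∣p∪q∣≤∣p∣+∣q∣ p q)) (≤-reflexive (sym (+-suc _ _)))
  ∣p∪q∣≤∣p∣+∣q∣ (outside ∷ p) (outside ∷ q) = ∣p∪q∣≤∣p∣+∣q∣ p q

  -- A failed inclusion has an explicit witness (membership is decidable).
  ⊈⇒∃ : ∀ (p q : Subset n) → ¬ (p ⊆ q) → ∃ λ x → x ∈ p × x ∉ q
  ⊈⇒∃ p q p⊈q with any? (λ x → (x ∈? p) ×-dec ¬? (x ∈? q))
  ... | yes witness = witness
  ... | no none = ⊥-elim (p⊈q p⊆q)
    where
    p⊆q : p ⊆ q
    p⊆q {x} x∈p with x ∈? q
    ... | yes x∈q = x∈q
    ... | no x∉q  = ⊥-elim (none (x , x∈p , x∉q))

module Covers where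

  open SubsetFacts
  open import Data.Nat using (_≤_; _+_; suc)
  open import Data.Nat.Properties using (≤-trans; ≤-reflexive; +-mono-≤; +-suc; module ≤-Reasoning)
  open import Data.Fin using (Fin)
  open import Data.Fin.Subset using (Subset; _∈_; _⊆_; _∩_; _∪_; ∁; ⋃; ∣_∣)
  open import Data.Fin.Subset.Properties
  open import Data.List using (List; []; _∷_; length; filter)
  open import Data.List.Membership.Propositional using () renaming (_∈_ to _∈ₗ_)
  open import Data.List.Relation.Unary.Any using (here; there)
  open import Data.List.Relation.Unary.All using (All; []; _∷_)
  import Data.List.Relation.Unary.All as All
  open import Data.Product using (∃; _×_; _,_)
  open import Data.Sum using (inj₁; inj₂)
  open import Function using (_∘′_)
  open import Relation.Nullary using (yes; no)
  open import Relation.Unary using (Pred; Decidable)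
  open import Relation.Unary.Properties using (∁?)
  open import Data.Empty using (⊥-elim)
  open import Relation.Binary.PropositionalEquality using (_≡_; refl; cong; trans)

  private
    variable
      n : ℕ
      x : Fin n

  ⊆⋃ : ∀ {K : Subset n} {Ks} → K ∈ₗ Ks → K ⊆ ⋃ Ks
  ⊆⋃ {Ks = K ∷ Ks} (here refl) = p⊆p∪q (⋃ Ks)
  ⊆⋃ {Ks = K ∷ Ks} (there i)   = q⊆p∪q K (⋃ Ks) ∘′ ⊆⋃ i

  ∈⋃⁻ : ∀ (Ks : List (Subset n)) → x ∈ ⋃ Ks → ∃ λ K → K ∈ₗ Ks × x ∈ K
  ∈⋃⁻ []       x∈⊥ = ⊥-elim (∉⊥ x∈⊥)
  ∈⋃⁻ (K ∷ Ks) x∈⋃ with x∈p∪q⁻ K (⋃ Ks) x∈⋃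
  ... | inj₁ x∈K = K , here refl , x∈K
  ... | inj₂ x∈⋃Ks with ∈⋃⁻ Ks x∈⋃Ks
  ...   | K′ , i , x∈K′ = K′ , there i , x∈K′

  ∣C∣≤#cover : ∀ (C : Subset n) Ks → C ⊆ ⋃ Ks → All (λ K → ∣ K ∩ C ∣ ≤ 1) Ks →
    ∣ C ∣ ≤ length Ks
  ∣C∣≤#cover {n} C [] C⊆⊥ [] = ≤-trans (p⊆q⇒∣p∣≤∣q∣ C⊆⊥) (≤-reflexive (∣⊥∣≡0 n))
  ∣C∣≤#cover C (K ∷ Ks) C⊆⋃ (∣K∩C∣≤1 ∷ ∣Ks∩C∣≤1) = begin
    ∣ C ∣                       ≤⟨ p⊆q⇒∣p∣≤∣q∣ C⊆split ⟩
    ∣ (K ∩ C) ∪ (C ∖ K) ∣       ≤⟨ ∣p∪q∣≤∣p∣+∣q∣ (K ∩ C) (C ∖ K) ⟩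
    ∣ K ∩ C ∣ + ∣ C ∖ K ∣       ≤⟨ +-mono-≤ ∣K∩C∣≤1 (∣C∣≤#cover (C ∖ K) Ks rest-covered rest-meets) ⟩
    suc (length Ks)             ∎
    where
    open ≤-Reasoning
    C⊆split : C ⊆ (K ∩ C) ∪ (C ∖ K)
    C⊆split {x} x∈C with x ∈? K
    ... | yes x∈K = p⊆p∪q (C ∖ K) (x∈p∩q⁺ (x∈K , x∈C))
    ... | no x∉K  = q⊆p∪q (K ∩ C) (C ∖ K) (x∈p∖q⁺ x∈C x∉K)
    rest-covered : C ∖ K ⊆ ⋃ Ks
    rest-covered x∈C∖K with x∈p∖q⁻ C K x∈C∖K
    ... | x∈C , x∉K with x∈p∪q⁻ K (⋃ Ks) (C⊆⋃ x∈C)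
    ...   | inj₁ x∈K   = ⊥-elim (x∉K x∈K)
    ...   | inj₂ x∈⋃Ks = x∈⋃Ks
    rest-meets : All (λ K′ → ∣ K′ ∩ (C ∖ K) ∣ ≤ 1) Ks
    rest-meets = All.map (λ {K′} → ≤-trans (p⊆q⇒∣p∣≤∣q∣ (∩-monoʳ K′ (p∩q⊆p C (∁ K))))) ∣Ks∩C∣≤1

  length-filter-split : ∀ {a p} {A : Set a} {P : Pred A p} (P? : Decidable P) (xs : List A) →
    length (filter P? xs) + length (filter (∁? P?) xs) ≡ length xs
  length-filter-split P? []       = refl
  length-filter-split P? (x ∷ xs) with P? x
  ... | yes _ = cong suc (length-filter-split P? xs)
  ... | no _  = trans (+-suc _ _) (cong suc (length-filter-split P? xs))

module Arithmetic where

  open import Data.Nat using (_≤_; _<_; _+_; _*_; zero; suc; z≤n; s≤s)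
  open import Data.Nat.Properties
  open import Data.Nat.Tactic.RingSolver using (solve-∀)
  open import Relation.Binary.PropositionalEquality using (_≡_; cong; sym)

  -- Bookkeeping for one merge step: c new vertices spread over k merged
  -- blobs (c ≤ k), r blobs kept apart, m = k + r blobs before the step.
  merge-count : ∀ {c k r m s t n} → c ≤ k → k + r ≡ m → s + m ≤ t + n →
    (c + s) + suc r ≤ suc (t + n)
  merge-count {c} {k} {r} {m} {s} {t} {n} c≤k k+r≡m s+m≤t+n = begin
    (c + s) + suc r    ≤⟨ +-monoˡ-≤ (suc r) (+-monoˡ-≤ s c≤k) ⟩
    (k + s) + suc r    ≡⟨ rearrange k s r ⟩
    suc (s + (k + r))  ≡⟨ cong (λ x → suc (s + x)) k+r≡m ⟩
    suc (s + m)        ≤⟨ s≤s s+m≤t+n ⟩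
    suc (t + n)        ∎
    where
    open ≤-Reasoning
    rearrange : ∀ k s r → (k + s) + suc r ≡ suc (s + (k + r))
    rearrange = solve-∀

  half : ∀ m {k} → 0 < k → m + m ≤ k → m < k
  half zero    0<k _      = 0<k
  half (suc m) _   2m≤k = <-≤-trans (m<m+n (suc m) (s≤s z≤n)) 2m≤k

  final-bound : ∀ {S t n} → 0 < n → S ≤ t + n → 3 * t ≤ S → S < 3 * n
  final-bound {S} {t} {n} 0<n S≤t+n 3t≤S =
    half S (*-monoʳ-< 3 0<n) (+-cancelˡ-≤ S (S + S) (3 * n) 3S≤S+3n)
    where
    open ≤-Reasoning
    3S≤S+3n : S + (S + S) ≤ S + 3 * n
    3S≤S+3n = begin
      S + (S + S)       ≡⟨ cong (λ x → S + (S + x)) (sym (+-identityʳ S)) ⟩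
      3 * S             ≤⟨ *-monoʳ-≤ 3 S≤t+n ⟩
      3 * (t + n)       ≡⟨ *-distribˡ-+ 3 t n ⟩
      3 * t + 3 * n     ≤⟨ +-monoˡ-≤ (3 * n) 3t≤S ⟩
      S + 3 * n         ∎

module Links {n : ℕ} (E : Digraph n) where

  open SubsetFacts
  open import Data.Nat using (_<_; z≤n; s≤s)
  open import Data.Nat.Properties using (≤-trans; ≤-<-trans; ≤-reflexive)
  open import Data.Fin using (Fin)
  open import Data.Fin.Subset using (Subset; _∈_; _∉_; _⊆_; _∩_; _∪_; ⊥; ⁅_⁆; ∣_∣; Empty; Nonempty)
  open import Data.Fin.Subset.Properties
  open import Data.Product using (∃; _×_; _,_; proj₁; proj₂)
  open import Data.Sum using (_⊎_; inj₁; inj₂; [_,_]′)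
  open import Data.Empty using (⊥-elim)
  open import Relation.Nullary using (yes; no)
  open import Relation.Binary.PropositionalEquality using (_≡_; _≢_; refl; subst)
  open import Function using (_∘_)

  private
    variable
      a b c d u v w y : Fin n
      U U′ C D D′ D₁ D₂ S X : Subset n

  _▹_ : Path E U u w → Path E U w v → Path E U u v
  here          ▹ q = q
  step e w∈U p ▹ q = step e w∈U (p ▹ q)

  path-mono : U ⊆ U′ → Path E U u v → Path E U′ u v
  path-mono U⊆U′ here           = here
  path-mono U⊆U′ (step e w∈U p) = step e (U⊆U′ w∈U) (path-mono U⊆U′ p)

  Joined : Subset n → Fin n → Fin n → Set
  Joined U u v = Path E U u v × Path E U v u

  joined-trans : Joined U u w → Joined U w v → Joined U u v
  joined-trans (p , p′) (q , q′) = p ▹ q , q′ ▹ p′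

  joined-mono : U ⊆ U′ → Joined U u v → Joined U′ u v
  joined-mono U⊆U′ (p , q) = path-mono U⊆U′ p , path-mono U⊆U′ q

  sc⇒joined : StronglyConnected E U → u ∈ U → v ∈ U → Joined U u v
  sc⇒joined {u = u} {v = v} sc u∈U v∈U = sc u v u∈U v∈U , sc v u v∈U u∈U

  sc-cong : U ⊆ U′ → U′ ⊆ U → StronglyConnected E U → StronglyConnected E U′
  sc-cong U⊆U′ U′⊆U sc u v u∈U′ v∈U′ = path-mono U⊆U′ (sc u v (U′⊆U u∈U′) (U′⊆U v∈U′))

  -- In a 2-vertex-connected set, deleting any X with |X| < 2 (not
  -- necessarily inside C) leaves C strongly connected: only X ∩ C matters.
  tvc-delete : TwoVertexConnected E C → ∣ X ∣ < 2 → StronglyConnected E (C ∖ X)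
  tvc-delete {C} {X} (_ , robust) ∣X∣<2 =
    sc-cong shrink grow (robust (X ∩ C) (p∩q⊆q X C) (≤-<-trans (∣p∩q∣≤∣p∣ X C) ∣X∣<2))
    where
    shrink : C ∖ (X ∩ C) ⊆ C ∖ X
    shrink x∈ with x∈p∖q⁻ C (X ∩ C) x∈
    ... | x∈C , x∉X∩C = x∈p∖q⁺ x∈C (λ x∈X → x∉X∩C (x∈p∩q⁺ (x∈X , x∈C)))
    grow : C ∖ X ⊆ C ∖ (X ∩ C)
    grow x∈ with x∈p∖q⁻ C X x∈
    ... | x∈C , x∉X = x∈p∖q⁺ x∈C (λ x∈X∩C → x∉X (proj₁ (x∈p∩q⁻ X C x∈X∩C)))

  tvc-strong : TwoVertexConnected E C → StronglyConnected E C
  tvc-strong {C} tvc =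
    sc-cong (proj₁ ∘ x∈p∖q⁻ C ⊥) (λ x∈C → x∈p∖q⁺ x∈C ∉⊥) (tvc-delete tvc ∣⊥∣<2)
    where
    ∣⊥∣<2 : ∣ ⊥ {n = n} ∣ < 2
    ∣⊥∣<2 = ≤-<-trans (≤-reflexive (∣⊥∣≡0 n)) (s≤s z≤n)

  Escapes : Subset n → Fin n → Fin n → Subset n → Fin n → Set
  Escapes D a b X y = (a ∉ X × Joined (D ∖ X) y a) ⊎ (b ∉ X × Joined (D ∖ X) y b)

  escapes-mono : D ⊆ D′ → Escapes D a b X y → Escapes D′ a b X y
  escapes-mono {X = X} D⊆D′ =
    [ (λ { (a∉X , j) → inj₁ (a∉X , joined-mono (∖-monoˡ X D⊆D′) j) })
    , (λ { (b∉X , j) → inj₂ (b∉X , joined-mono (∖-monoˡ X D⊆D′) j) }) ]′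

  escapes-swap : Escapes D a b X y → Escapes D b a X y
  escapes-swap = [ inj₂ , inj₁ ]′

  -- Blocks are links, and links compose through cut vertices
  -- (glue); attaching a link to a 2-vertex-connected set keeps it so (extend).
  record Link (D : Subset n) (a b : Fin n) : Set where
    field
      source : a ∈ D
      target : b ∈ D
      strong : StronglyConnected E D
      escape : ∣ X ∣ < 2 → y ∈ D ∖ X → Escapes D a b X y
  open Link

  link-sym : Link D a b → Link D b a
  link-sym l = record
    { source = target l ; target = source l ; strong = strong l
    ; escape = λ ∣X∣<2 y∈ → escapes-swap (escape l ∣X∣<2 y∈) }

  module _ (l₁ : Link D₁ a c) (l₂ : Link D₂ c b) where

    -- The union of two links through c is strongly connected via c.
    private
      joined-to-cut : u ∈ D₁ ∪ D₂ → Joined (D₁ ∪ D₂) u c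
      joined-to-cut u∈ with x∈p∪q⁻ D₁ D₂ u∈
      ... | inj₁ u∈D₁ = joined-mono (p⊆p∪q D₂) (sc⇒joined (strong l₁) u∈D₁ (target l₁))
      ... | inj₂ u∈D₂ = joined-mono (q⊆p∪q D₁ D₂) (sc⇒joined (strong l₂) u∈D₂ (source l₂))

    glue-strong : StronglyConnected E (D₁ ∪ D₂)
    glue-strong u v u∈ v∈ = proj₁ (joined-to-cut u∈) ▹ proj₂ (joined-to-cut v∈)

    -- If X misses D₂, all of D₂ survives, so whatever escapes to c escapes to b.
    escape-missing₂ : ∣ X ∣ < 2 → Empty (D₂ ∩ X) → y ∈ (D₁ ∪ D₂) ∖ X →
      Escapes (D₁ ∪ D₂) a b X y
    escape-missing₂ {X} {y} ∣X∣<2 miss y∈ = by-side (x∈p∪q⁻ D₁ D₂ (proj₁ y∈∪∖X))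
      where
      y∈∪∖X = x∈p∖q⁻ (D₁ ∪ D₂) X y∈
      D₂-survives : D₂ ⊆ (D₁ ∪ D₂) ∖ X
      D₂-survives z∈D₂ = x∈p∖q⁺ (q⊆p∪q D₁ D₂ z∈D₂) (λ z∈X → miss (_ , x∈p∩q⁺ (z∈D₂ , z∈X)))
      b∉X : b ∉ X
      b∉X = proj₂ (x∈p∖q⁻ (D₁ ∪ D₂) X (D₂-survives (target l₂)))
      joined-to-b : u ∈ D₂ → Joined ((D₁ ∪ D₂) ∖ X) u b
      joined-to-b u∈D₂ = joined-mono D₂-survives (sc⇒joined (strong l₂) u∈D₂ (target l₂))
      via-cut : Escapes D₁ a c X y → Escapes (D₁ ∪ D₂) a b X y
      via-cut (inj₁ (a∉X , j)) = inj₁ (a∉X , joined-mono (∖-monoˡ X (p⊆p∪q D₂)) j)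
      via-cut (inj₂ (_ , j))   =
        inj₂ (b∉X , joined-trans (joined-mono (∖-monoˡ X (p⊆p∪q D₂)) j) (joined-to-b (source l₂)))
      by-side : y ∈ D₁ ⊎ y ∈ D₂ → Escapes (D₁ ∪ D₂) a b X y
      by-side (inj₁ y∈D₁) = via-cut (escape l₁ ∣X∣<2 (x∈p∖q⁺ y∈D₁ (proj₂ y∈∪∖X)))
      by-side (inj₂ y∈D₂) = inj₂ (b∉X , joined-to-b y∈D₂)

    -- If the cut vertex c itself is deleted, each side escapes to its own endpoint.
    escape-cut : ∣ X ∣ < 2 → c ∈ X → y ∈ (D₁ ∪ D₂) ∖ X → Escapes (D₁ ∪ D₂) a b X y
    escape-cut {X} {y} ∣X∣<2 c∈X y∈ with x∈p∖q⁻ (D₁ ∪ D₂) X y∈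
    ... | y∈∪ , y∉X with x∈p∪q⁻ D₁ D₂ y∈∪
    ...   | inj₁ y∈D₁ = escapes-mono (p⊆p∪q D₂) (keep-a (escape l₁ ∣X∣<2 (x∈p∖q⁺ y∈D₁ y∉X)))
      where
      keep-a : Escapes D₁ a c X y → Escapes D₁ a b X y
      keep-a (inj₁ e)        = inj₁ e
      keep-a (inj₂ (c∉X , _)) = ⊥-elim (c∉X c∈X)
    ...   | inj₂ y∈D₂ = escapes-mono (q⊆p∪q D₁ D₂) (keep-b (escape l₂ ∣X∣<2 (x∈p∖q⁺ y∈D₂ y∉X)))
      where
      keep-b : Escapes D₂ c b X y → Escapes D₂ a b X y
      keep-b (inj₁ (c∉X , _)) = ⊥-elim (c∉X c∈X)
      keep-b (inj₂ e)        = inj₂ e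

  cut-deleted : (∀ {z} → z ∈ D₁ → z ∈ D₂ → z ≡ c) → ∣ X ∣ < 2 →
    Nonempty (D₁ ∩ X) → Nonempty (D₂ ∩ X) → c ∈ X
  cut-deleted {D₁} {D₂} {X = X} meet ∣X∣<2 (x₁ , x₁∈) (x₂ , x₂∈)
    with x∈p∩q⁻ D₁ X x₁∈ | x∈p∩q⁻ D₂ X x₂∈
  ... | x₁∈D₁ , x₁∈X | x₂∈D₂ , x₂∈X =
    subst (_∈ X) (meet x₁∈D₁ (subst (_∈ D₂) (∣X∣<2⇒AtMostOne ∣X∣<2 x₂∈X x₁∈X) x₂∈D₂)) x₁∈X

  glue : Link D₁ a c → Link D₂ c b → (∀ {z} → z ∈ D₁ → z ∈ D₂ → z ≡ c) → Link (D₁ ∪ D₂) a b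
  glue {D₁} {D₂ = D₂} l₁ l₂ meet = record
    { source = p⊆p∪q D₂ (source l₁)
    ; target = q⊆p∪q D₁ D₂ (target l₂)
    ; strong = glue-strong l₁ l₂
    ; escape = glue-escape }
    where
    glue-escape : ∣ X ∣ < 2 → y ∈ (D₁ ∪ D₂) ∖ X → Escapes (D₁ ∪ D₂) _ _ X y
    glue-escape {X} ∣X∣<2 y∈ with nonempty? (D₂ ∩ X) | nonempty? (D₁ ∩ X)
    ... | no miss₂ | _        = escape-missing₂ l₁ l₂ ∣X∣<2 miss₂ y∈
    ... | yes _    | no miss₁ =
      escapes-swap (escapes-mono (∪-swap D₂ D₁)
        (escape-missing₂ (link-sym l₂) (link-sym l₁) ∣X∣<2 miss₁ (∖-monoˡ X (∪-swap D₁ D₂) y∈)))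
    ... | yes hit₂ | yes hit₁ = escape-cut l₁ l₂ ∣X∣<2 (cut-deleted meet ∣X∣<2 hit₁ hit₂) y∈

  glue₃ : Link D₁ a c → Link D c d → Link D₂ d b →
    (∀ {z} → z ∈ D₁ → z ∈ D → z ≡ c) → (∀ {z} → z ∈ D → z ∈ D₂ → z ≡ d) →
    (∀ {z} → z ∈ D₁ → z ∉ D₂) → Link ((D₁ ∪ D) ∪ D₂) a b
  glue₃ {D₁} {D = D} {d = d} {D₂ = D₂} l₁ l l₂ meet₁ meet₂ disjoint = glue (glue l₁ l meet₁) l₂ meet
    where
    meet : ∀ {z} → z ∈ D₁ ∪ D → z ∈ D₂ → z ≡ d
    meet z∈ z∈D₂ with x∈p∪q⁻ D₁ D z∈
    ... | inj₁ z∈D₁ = ⊥-elim (disjoint z∈D₁ z∈D₂)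
    ... | inj₂ z∈D  = meet₂ z∈D z∈D₂

  singleton-link : Link ⁅ a ⁆ a a
  singleton-link {a} = record
    { source = x∈⁅x⁆ a ; target = x∈⁅x⁆ a ; strong = strong′ ; escape = escape′ }
    where
    strong′ : StronglyConnected E ⁅ a ⁆
    strong′ u v u∈ v∈ with x∈⁅y⁆⇒x≡y a u∈ | x∈⁅y⁆⇒x≡y a v∈
    ... | refl | refl = here
    escape′ : ∣ X ∣ < 2 → y ∈ ⁅ a ⁆ ∖ X → Escapes ⁅ a ⁆ a a X y
    escape′ {X} _ y∈ with x∈p∖q⁻ ⁅ a ⁆ X y∈
    ... | y∈⁅a⁆ , y∉X with x∈⁅y⁆⇒x≡y a y∈⁅a⁆
    ...   | refl = inj₁ (y∉X , here , here)

  -- Two distinct vertices u, v of a 2-vertex-connected set C are linked by C: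
  -- a deletion of fewer than two vertices spares u or v, and C stays connected.
  block-link : TwoVertexConnected E C → u ∈ C → v ∈ C → u ≢ v → Link C u v
  block-link {C} {u} {v} tvc u∈C v∈C u≢v = record
    { source = u∈C ; target = v∈C ; strong = tvc-strong tvc ; escape = escape′ }
    where
    escape′ : ∣ X ∣ < 2 → y ∈ C ∖ X → Escapes C u v X y
    escape′ {X} ∣X∣<2 y∈ with u ∈? X
    ... | no u∉X  = inj₁ (u∉X , sc⇒joined (tvc-delete tvc ∣X∣<2) y∈ (x∈p∖q⁺ u∈C u∉X))
    ... | yes u∈X = inj₂ (v∉X , sc⇒joined (tvc-delete tvc ∣X∣<2) y∈ (x∈p∖q⁺ v∈C v∉X))
      where
      v∉X : v ∉ X
      v∉X v∈X = u≢v (∣X∣<2⇒AtMostOne ∣X∣<2 u∈X v∈X)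

  -- Attaching a link between two vertices of a 2-vertex-connected set S keeps
  -- it 2-vertex-connected: after a deletion every vertex is joined to a
  -- surviving vertex of S, and S itself stays strongly connected.
  extend : TwoVertexConnected E S → a ∈ S → b ∈ S → Link D a b → TwoVertexConnected E (S ∪ D)
  extend {S} {a} {b} {D} tvc a∈S b∈S l = ≤-trans (proj₁ tvc) (∣p∣≤∣p∪q∣ S D) , robust
    where
    robust : ∀ X → X ⊆ S ∪ D → ∣ X ∣ < 2 → StronglyConnected E ((S ∪ D) ∖ X)
    robust X _ ∣X∣<2 u v u∈ v∈ = route (anchor u∈) (anchor v∈)
      where
      Anchor : Fin n → Set
      Anchor w = ∃ λ s → s ∈ S ∖ X × Joined ((S ∪ D) ∖ X) w s
      anchor : w ∈ (S ∪ D) ∖ X → Anchor w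
      anchor {w} w∈ with x∈p∖q⁻ (S ∪ D) X w∈
      ... | w∈∪ , w∉X with x∈p∪q⁻ S D w∈∪
      ...   | inj₁ w∈S = w , x∈p∖q⁺ w∈S w∉X , here , here
      ...   | inj₂ w∈D with escape l ∣X∣<2 (x∈p∖q⁺ w∈D w∉X)
      ...     | inj₁ (a∉X , j) = a , x∈p∖q⁺ a∈S a∉X , joined-mono (∖-monoˡ X (q⊆p∪q S D)) j
      ...     | inj₂ (b∉X , j) = b , x∈p∖q⁺ b∈S b∉X , joined-mono (∖-monoˡ X (q⊆p∪q S D)) j
      route : Anchor u → Anchor v → Path E ((S ∪ D) ∖ X) u v
      route (s , s∈ , ju) (t , t∈ , jv) =
        proj₁ ju ▹ (path-mono (∖-monoˡ X (p⊆p∪q D)) (tvc-delete tvc ∣X∣<2 s t s∈ t∈) ▹ proj₂ jv)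

module Forests {n : ℕ} (E : Digraph n) where

  open SubsetFacts
  open Covers
  open Links E
  open import Data.Nat using (_≤_; _+_; _*_; z≤n)
  open import Data.Nat.Properties using (≤-reflexive; *-suc; +-mono-≤)
  open Arithmetic using (merge-count)
  open import Data.Fin using (Fin; _≟_)
  open import Data.Fin.Subset using (Subset; _∈_; _∉_; _⊆_; _∩_; _∪_; ⋃; ⁅_⁆; ∣_∣; Nonempty)
  open import Data.Fin.Subset.Properties
  open import Function using (_∘_)
  open import Data.List using (List; []; _∷_; length; map; filter; tabulate)
  open import Data.List.Properties using (length-tabulate)
  open import Data.Nat.ListAction using (sum)
  open import Data.List.Membership.Propositional using () renaming (_∈_ to _∈ₗ_)
  open import Data.List.Membership.Propositional.Properties using (∈-filter⁺; ∈-filter⁻; ∈-tabulate⁺; ∈-tabulate⁻)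
  open import Data.List.Relation.Unary.Any using (here; there)
  open import Data.List.Relation.Unary.All using (All; []; _∷_)
  open import Data.List.Relation.Unary.Unique.Propositional using (Unique)
  open import Data.List.Relation.Unary.AllPairs using (_∷_)
  import Data.List.Relation.Unary.All as All
  open import Data.Product using (∃; _×_; _,_; proj₁; proj₂)
  open import Data.Sum using (inj₁; inj₂)
  open import Data.Empty using (⊥; ⊥-elim)
  open import Relation.Nullary using (Dec; yes; no; ¬_)
  open import Relation.Unary.Properties using (∁?)
  open import Relation.Binary.PropositionalEquality using (_≡_; _≢_; refl; sym; trans; cong; subst)

  private
    variable
      a b c : Fin n
      B C K K′ : Subset n
      L L′ : List (Subset n)

  record Bridge (L : List (Subset n)) (K : Subset n) (a b : Fin n) : Set where
    field
      carrier : Subset n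
      inside  : carrier ⊆ K
      link    : Link carrier a b
      block   : Subset n
      block∈L : block ∈ₗ L
      block⊆  : block ⊆ carrier

  Fused : List (Subset n) → Subset n → Set
  Fused L K = ∀ {a b} → a ∈ K → b ∈ K → a ≢ b → Bridge L K a b

  bridge-weaken : (∀ {B} → B ∈ₗ L → B ∈ₗ L′) → K ⊆ K′ → Bridge L K a b → Bridge L′ K′ a b
  bridge-weaken L⊆L′ K⊆K′ br = record
    { carrier = carrier ; inside = K⊆K′ ∘ inside ; link = link
    ; block = block ; block∈L = L⊆L′ block∈L ; block⊆ = block⊆ }
    where open Bridge br

  fused-link : Fused L K → a ∈ K → c ∈ K → ∃ λ D → D ⊆ K × Link D a c
  fused-link {K = K} {a} {c} fused a∈K c∈K with a ≟ c
  ... | yes refl = ⁅ a ⁆ , (λ z∈ → subst (_∈ K) (sym (x∈⁅y⁆⇒x≡y a z∈)) a∈K) , singleton-link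
  ... | no a≢c   = carrier , inside , link
    where open Bridge (fused a∈K c∈K a≢c)

  -- A component B differing from a 2-vertex-connected set C has a vertex
  -- outside C; otherwise B ⊂ C would contradict the maximality of B.
  vertex-outside : IsTwoVCC E B → TwoVertexConnected E C → B ≢ C → ∃ λ w → w ∈ B × w ∉ C
  vertex-outside {B} {C} (_ , maximal) tvc B≢C with B ⊆? C
  ... | no B⊈C = ⊈⇒∃ B C B⊈C
  ... | yes B⊆C with C ⊆? B
  ...   | yes C⊆B = ⊥-elim (B≢C (⊆-antisym B⊆C C⊆B))
  ...   | no C⊈B  = ⊥-elim (maximal C (B⊆C , ⊈⇒∃ C B C⊈B) tvc)

  -- Two common vertices x ≢ y are bridged in K
  -- by a link D containing some B ∈ L; attaching D to C gives the
  -- 2-vertex-connected set C ∪ D, which is strictly larger than C because B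
  -- has a vertex outside C — contradicting the maximality of C.
  meets-fused-once : IsTwoVCC E C → All (C ≢_) L → All (IsTwoVCC E) L → Fused L K →
    AtMostOne (K ∩ C)
  meets-fused-once {C} {L} {K} (tvc , maximal) C∉L L-comps fused {x} {y} x∈ y∈ with x ≟ y
  ... | yes x≡y = x≡y
  ... | no x≢y  = ⊥-elim (maximal (C ∪ carrier) C⊂C∪D (extend tvc x∈C y∈C link))
    where
    x∈C = proj₂ (x∈p∩q⁻ K C x∈)
    y∈C = proj₂ (x∈p∩q⁻ K C y∈)
    open Bridge (fused (proj₁ (x∈p∩q⁻ K C x∈)) (proj₁ (x∈p∩q⁻ K C y∈)) x≢y)
    outside : ∃ λ w → w ∈ block × w ∉ C
    outside = vertex-outside (All.lookup L-comps block∈L) tvc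
                (λ block≡C → All.lookup C∉L block∈L (sym block≡C))
    C⊂C∪D : C ⊆ C ∪ carrier × ∃ λ w → w ∈ C ∪ carrier × w ∉ C
    C⊂C∪D with outside
    ... | w , w∈B , w∉C = p⊆p∪q carrier , w , q⊆p∪q C carrier (block⊆ w∈B) , w∉C

  record Forest (L : List (Subset n)) : Set where
    field
      blobs     : List (Subset n)
      covered   : ∀ x → ∃ λ K → K ∈ₗ blobs × x ∈ K
      separated : ∀ {K₁ K₂ z} → K₁ ∈ₗ blobs → K₂ ∈ₗ blobs → z ∈ K₁ → z ∈ K₂ → K₁ ≡ K₂
      fused     : ∀ {K} → K ∈ₗ blobs → Fused L K
      count     : sum (map ∣_∣ L) + length blobs ≤ length L + n

  initial-forest : Forest []
  initial-forest = record
    { blobs     = tabulate ⁅_⁆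
    ; covered   = λ x → ⁅ x ⁆ , ∈-tabulate⁺ x , x∈⁅x⁆ x
    ; separated = separated′
    ; fused     = fused′
    ; count     = ≤-reflexive (length-tabulate ⁅_⁆) }
    where
    separated′ : ∀ {K₁ K₂ z} → K₁ ∈ₗ tabulate ⁅_⁆ → K₂ ∈ₗ tabulate ⁅_⁆ → z ∈ K₁ → z ∈ K₂ → K₁ ≡ K₂
    separated′ i₁ i₂ z∈K₁ z∈K₂ with ∈-tabulate⁻ {f = ⁅_⁆} i₁ | ∈-tabulate⁻ {f = ⁅_⁆} i₂
    ... | x₁ , refl | x₂ , refl = cong ⁅_⁆ (trans (sym (x∈⁅y⁆⇒x≡y x₁ z∈K₁)) (x∈⁅y⁆⇒x≡y x₂ z∈K₂))
    fused′ : ∀ {K} → K ∈ₗ tabulate ⁅_⁆ → Fused [] K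
    fused′ i a∈ b∈ a≢b with ∈-tabulate⁻ {f = ⁅_⁆} i
    ... | x , refl = ⊥-elim (a≢b (trans (x∈⁅y⁆⇒x≡y x a∈) (sym (x∈⁅y⁆⇒x≡y x b∈))))

  module Step (C-comp : IsTwoVCC E C) (C∉L : All (C ≢_) L) (L-comps : All (IsTwoVCC E) L)
              (forest : Forest L) where
    open Forest forest

    touches? : (K : Subset n) → Dec (Nonempty (K ∩ C))
    touches? K = nonempty? (K ∩ C)

    touching apart : List (Subset n)
    touching = filter touches? blobs
    apart    = filter (∁? touches?) blobs

    merged : Subset n
    merged = ⋃ touching

    touching-blob : K ∈ₗ touching → K ∈ₗ blobs × Nonempty (K ∩ C)
    touching-blob = ∈-filter⁻ touches? {xs = blobs}

    apart-blob : K ∈ₗ apart → K ∈ₗ blobs × ¬ Nonempty (K ∩ C)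
    apart-blob = ∈-filter⁻ (∁? touches?) {xs = blobs}

    meets-once : K ∈ₗ blobs → AtMostOne (K ∩ C)
    meets-once i = meets-fused-once C-comp C∉L L-comps (fused i)

    C⊆merged : C ⊆ merged
    C⊆merged {x} x∈C with covered x
    ... | K , i , x∈K = ⊆⋃ (∈-filter⁺ touches? i (x , x∈p∩q⁺ (x∈K , x∈C))) x∈K

    -- Vertices a, b in different touching blobs: go from a to the vertex ca
    -- where its blob meets C, through C to cb, and on to b.  Consecutive links
    -- meet only in ca resp. cb, so they glue into a bridge containing C.
    cross-bridge : ∀ {Ka Kb a b} → Ka ∈ₗ touching → Kb ∈ₗ touching →
      a ∈ Ka → b ∈ Kb → b ∉ Ka → Bridge (C ∷ L) merged a b
    cross-bridge {Ka} {Kb} {a} {b} ia ib a∈Ka b∈Kb b∉Ka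
      with touching-blob ia | touching-blob ib
    ... | Ka∈ , ca , ca∈KaC | Kb∈ , cb , cb∈KbC
      with fused-link (fused Ka∈) a∈Ka (proj₁ (x∈p∩q⁻ Ka C ca∈KaC))
         | fused-link (fused Kb∈) (proj₁ (x∈p∩q⁻ Kb C cb∈KbC)) b∈Kb
    ... | Da , Da⊆Ka , la | Db , Db⊆Kb , lb = record
      { carrier = (Da ∪ C) ∪ Db
      ; inside  = ∪-least (∪-least (⊆⋃ ia ∘ Da⊆Ka) C⊆merged) (⊆⋃ ib ∘ Db⊆Kb)
      ; link    = glue₃ la lC lb meet-a meet-b (λ z∈Da z∈Db → disjoint (Da⊆Ka z∈Da) (Db⊆Kb z∈Db))
      ; block   = C ; block∈L = here refl ; block⊆ = p⊆p∪q Db ∘ q⊆p∪q Da C }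
      where
      disjoint : ∀ {z} → z ∈ Ka → z ∈ Kb → ⊥
      disjoint z∈Ka z∈Kb = b∉Ka (subst (b ∈_) (sym (separated Ka∈ Kb∈ z∈Ka z∈Kb)) b∈Kb)
      ca≢cb : ca ≢ cb
      ca≢cb refl = disjoint (proj₁ (x∈p∩q⁻ Ka C ca∈KaC)) (proj₁ (x∈p∩q⁻ Kb C cb∈KbC))
      lC : Link C ca cb
      lC = block-link (proj₁ C-comp) (proj₂ (x∈p∩q⁻ Ka C ca∈KaC)) (proj₂ (x∈p∩q⁻ Kb C cb∈KbC)) ca≢cb
      meet-a : ∀ {z} → z ∈ Da → z ∈ C → z ≡ ca
      meet-a z∈Da z∈C = meets-once Ka∈ (x∈p∩q⁺ (Da⊆Ka z∈Da , z∈C)) ca∈KaC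
      meet-b : ∀ {z} → z ∈ C → z ∈ Db → z ≡ cb
      meet-b z∈C z∈Db = meets-once Kb∈ (x∈p∩q⁺ (Db⊆Kb z∈Db , z∈C)) cb∈KbC

    -- The merged blob is fused by C ∷ L: two of its vertices either share an
    -- old blob, fused by L, or are joined by a cross bridge.
    merged-fused : Fused (C ∷ L) merged
    merged-fused {a} {b} a∈ b∈ a≢b with ∈⋃⁻ touching a∈ | ∈⋃⁻ touching b∈
    ... | Ka , ia , a∈Ka | Kb , ib , b∈Kb with b ∈? Ka
    ...   | yes b∈Ka = bridge-weaken there (⊆⋃ ia) (fused (proj₁ (touching-blob ia)) a∈Ka b∈Ka a≢b)
    ...   | no b∉Ka  = cross-bridge ia ib a∈Ka b∈Kb b∉Ka

    merged-apart : ∀ {R z} → R ∈ₗ apart → z ∈ merged → z ∈ R → ⊥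
    merged-apart iR z∈ z∈R with ∈⋃⁻ touching z∈ | apart-blob iR
    ... | K , iK , z∈K | R∈ , R-misses =
      R-misses (subst (λ K → Nonempty (K ∩ C)) (separated (proj₁ (touching-blob iK)) R∈ z∈K z∈R)
                      (proj₂ (touching-blob iK)))

    new-blobs : List (Subset n)
    new-blobs = merged ∷ apart

    new-covered : ∀ x → ∃ λ K → K ∈ₗ new-blobs × x ∈ K
    new-covered x with covered x
    ... | K , i , x∈K with touches? K
    ...   | yes t = merged , here refl , ⊆⋃ (∈-filter⁺ touches? i t) x∈K
    ...   | no t  = K , there (∈-filter⁺ (∁? touches?) i t) , x∈K

    new-separated : ∀ {K₁ K₂ z} → K₁ ∈ₗ new-blobs → K₂ ∈ₗ new-blobs → z ∈ K₁ → z ∈ K₂ → K₁ ≡ K₂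
    new-separated (here refl) (here refl) _   _   = refl
    new-separated (here refl) (there i₂)  z∈₁ z∈₂ = ⊥-elim (merged-apart i₂ z∈₁ z∈₂)
    new-separated (there i₁)  (here refl) z∈₁ z∈₂ = ⊥-elim (merged-apart i₁ z∈₂ z∈₁)
    new-separated (there i₁)  (there i₂)  z∈₁ z∈₂ =
      separated (proj₁ (apart-blob i₁)) (proj₁ (apart-blob i₂)) z∈₁ z∈₂

    new-fused : ∀ {K} → K ∈ₗ new-blobs → Fused (C ∷ L) K
    new-fused (here refl) = merged-fused
    new-fused (there i) a∈ b∈ a≢b =
      bridge-weaken there (λ z∈ → z∈) (fused (proj₁ (apart-blob i)) a∈ b∈ a≢b)

    ∣C∣≤#touching : ∣ C ∣ ≤ length touching
    ∣C∣≤#touching = ∣C∣≤#cover C touching C⊆merged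
      (All.tabulate (λ i → AtMostOne⇒∣X∣≤1 _ (meets-once (proj₁ (touching-blob i)))))

    -- The size sum grows by |C| while the number of blobs drops by
    -- |touching| - 1 ≥ |C| - 1; so the left side of count grows by at most
    -- one, just like the number of components.
    forest-step : Forest (C ∷ L)
    forest-step = record
      { blobs     = new-blobs
      ; covered   = new-covered
      ; separated = new-separated
      ; fused     = new-fused
      ; count     = merge-count {t = length L} ∣C∣≤#touching (length-filter-split touches? blobs) count }

  forest : ∀ L → Unique L → All (IsTwoVCC E) L → Forest L
  forest []      _                  _                  = initial-forest
  forest (C ∷ L) (C∉L ∷ L-distinct) (C-comp ∷ L-comps) =
    Step.forest-step C-comp C∉L L-comps (forest L L-distinct L-comps)

  three-per-component : ∀ {Cs} → All (IsTwoVCC E) Cs → 3 * length Cs ≤ sum (map ∣_∣ Cs)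
  three-per-component []                  = z≤n
  three-per-component {C ∷ Cs} (C-comp ∷ comps) =
    subst (_≤ ∣ C ∣ + sum (map ∣_∣ Cs)) (sym (*-suc 3 (length Cs)))
      (+-mono-≤ (proj₁ (proj₁ C-comp)) (three-per-component comps))

open import Data.Nat using (_<_; _*_)
open import Data.Nat.Properties using (≤-trans; m≤m+n)
open import Data.Fin.Subset using (Subset; ∣_∣)
open import Data.List using (List; map)
open import Data.Nat.ListAction using (sum)
open import Data.List.Membership.Propositional using (_∈_)
open import Data.List.Relation.Unary.Unique.Propositional using (Unique)
open import Data.List.Relation.Unary.All as All using (All)
open import Function.Bundles using (_⇔_; Equivalence)
open Arithmetic using (final-bound)

lemma7 : (n : ℕ) → 0 < n → (E : Digraph n) → (Cs : List (Subset n)) →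
    Unique Cs → (∀ C → (C ∈ Cs) ⇔ IsTwoVCC E C) →
    sum (map ∣_∣ Cs) < 3 * n
lemma7 n 0<n E Cs distinct components =
  final-bound 0<n (≤-trans (m≤m+n _ _) count) (three-per-component comps)
  where
  open Forests E
  comps : All (IsTwoVCC E) Cs
  comps = All.tabulate (λ {C} C∈Cs → Equivalence.to (components C) C∈Cs)
  open Forest (forest Cs distinct comps)
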